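{- Let $R$ be a $p_2$-orientation of a path $P_n$. If two adjacent edges $e_j, e_{j+1}$ of $R$ are both right edges, then both edges $e_{j-1}$ and $e_{j+2}$ exist and are left edges. Conversely, if $e_j,e_{j+1}$ are both left edges, then both $e_{j-1}$ and $e_{j+2}$ exist and are right edges.
   Context: Parallel Diffusion on a finite simple graph $G$: a configuration assigns an integer stack size $|v|$ (possibly negative) to each vertex. In one step all vertices fire simultaneously: each vertex sends one chip to each neighbour with strictly smaller stack size. Starting from $C_0$, $C_{t+1}$ is obtained from $C_t$ by one step. A configuration $D$ is a $p_2$-configuration if there are $C_0$ and $N$ such that $C_{t+2}=C_t$ and $C_{t+1}\ne C_t$ for all $t\ge N$, and $D=C_t$ for some $t\ge N$. The path $P_n$ has vertices $v_1,\dots,v_n$ and edges $e_i=v_iv_{i+1}$, drawn horizontally with $v_1$ rightmost. A configuration induces the orientation in which each edge is directed from its endpoint with larger stack size to its endpoint with smaller stack size, and is flat if the stack sizes are equal; a $p_2$-orientation is an orientation induced by a $p_2$-configuration. A directed edge $e_i$ is a right edge if directed $v_{i+1}\to v_i$ and a left edge if directed $v_i\to v_{i+1}$. -}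

module Defs where

open import Data.Nat as ℕ using (ℕ; zero; suc; _≤_)
open import Data.Nat.Properties using (_<?_)
open import Data.Fin using (Fin; toℕ; fromℕ<)
open import Data.Integer as ℤ using (ℤ; +_; -[1+_])
open import Data.Integer.Properties as ℤP using ()
open import Data.Maybe using (Maybe; just; nothing)
open import Data.Product using (Σ; _×_)
open import Relation.Nullary using (¬_; yes; no)
open import Relation.Binary.PropositionalEquality using (_≡_)

-- A configuration on the path P_n: vertex v_{k+1} is the element k of Fin n.
Config : ℕ → Set
Config n = Fin n → ℤ

-- |v_k| for the 1-based vertex index k; nothing if v_k does not exist.
stack : ∀ {n} → Config n → ℕ → Maybe ℤ
stack {n} C zero = nothing
stack {n} C (suc m) with m <? n
... | yes p = just (C (fromℕ< p))
... | no _  = nothing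

-- net chips received by a vertex of stack size x from a (possibly
-- non-existent) neighbour: +1 if the neighbour's stack is strictly larger,
-- -1 if strictly smaller, 0 otherwise.
flow : ℤ → Maybe ℤ → ℤ
flow x nothing = + 0
flow x (just a) with x ℤP.<? a
... | yes _ = + 1
... | no _ with a ℤP.<? x
...   | yes _ = -[1+ 0 ]
...   | no _  = + 0

-- One step of Parallel Diffusion on P_n (all vertices fire simultaneously).
-- The element i of Fin n is vertex v_k with k = toℕ i + 1; its neighbours
-- are v_{k-1} and v_{k+1} (when they exist).
step : ∀ {n} → Config n → Config n
step C i = C i ℤ.+ flow (C i) (stack C (toℕ i)) ℤ.+ flow (C i) (stack C (suc (suc (toℕ i))))

iter : ∀ {n} → ℕ → Config n → Config n
iter zero    C = C
iter (suc t) C = step (iter t C)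

_≈_ : ∀ {n} → Config n → Config n → Set
C ≈ D = ∀ i → C i ≡ D i

IsP2Config : ∀ {n} → Config n → Set
IsP2Config {n} D =
  Σ (Config n) λ C₀ → Σ ℕ λ N →
    (∀ t → N ≤ t → (iter (suc (suc t)) C₀ ≈ iter t C₀) × ¬ (iter (suc t) C₀ ≈ iter t C₀))
    × Σ ℕ λ t → N ≤ t × (D ≈ iter t C₀)

-- e_j = v_j v_{j+1} is a right edge of the induced orientation:
-- directed v_{j+1} → v_j, i.e. |v_{j+1}| > |v_j| (both vertices exist).
RightEdge : ∀ {n} → Config n → ℕ → Set
RightEdge C j = Σ ℤ λ a → Σ ℤ λ b → stack C j ≡ just a × stack C (suc j) ≡ just b × a ℤ.< b

-- e_j is a left edge: directed v_j → v_{j+1}, i.e. |v_j| > |v_{j+1}|.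
LeftEdge : ∀ {n} → Config n → ℕ → Set
LeftEdge C j = Σ ℤ λ a → Σ ℤ λ b → stack C j ≡ just a × stack C (suc j) ≡ just b × b ℤ.< a

-- In a period-2 orbit D, D′ = step D, every edge carries opposite flows in the two
-- configurations: summing the chips a vertex receives over both steps gives zero, so,
-- inducting from the end vertex v₁, the flow across its left edge cancels and hence
-- so does the flow across its right edge.  Now let e_j, e_{j+1} be right edges, i.e.
-- |v_j| < |v_{j+1}| < |v_{j+2}|.  The middle vertex loses and gains a chip, so it keeps
-- its size y; the edge e_j reverses, so v_j must grow from below y to above y in one
-- step, which needs a chip from a higher v_{j-1}; dually v_{j+2} must drop below y,
-- which needs a lower v_{j+3}.  Negating all stack sizes commutes with the dynamics and
-- exchanges left and right edges, which gives the second half.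
module Submission where

open import Defs
open import Data.Nat using (ℕ; zero; suc; _+_)
import Data.Nat.Properties as ℕ
open import Data.Fin using (toℕ; fromℕ<)
open import Data.Fin.Properties using (toℕ-fromℕ<)
open import Data.Integer as ℤ using (ℤ; _<_; 0ℤ; 1ℤ; -1ℤ; -_)
open import Data.Integer.Properties
  using (<-cmp; <-irrefl; <-asym; ≤⇒≯; i<j⇒suc[i]≤j; i<j⇒i≤pred[j]; neg-mono-<;
         neg-involutive; neg-distrib-+; _<?_)
open import Data.Integer.Tactic.RingSolver using (solve-∀)
open import Data.Maybe using (Maybe; just; nothing; map)
open import Data.Maybe.Properties using (just-injective; map-just)
open import Data.Product using (Σ; _×_; _,_; proj₁)
open import Data.Empty using (⊥-elim)
open import Relation.Binary.Definitions using (tri<; tri≈; tri>)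
open import Relation.Nullary using (yes; no)
open import Relation.Binary.PropositionalEquality
  using (_≡_; refl; sym; trans; cong; cong₂; subst; subst₂; module ≡-Reasoning)

flow-< : ∀ {x a} → x < a → flow x (just a) ≡ 1ℤ
flow-< {x} {a} x<a with x <? a
... | yes _    = refl
... | no x≮a = ⊥-elim (x≮a x<a)

flow-> : ∀ {x a} → a < x → flow x (just a) ≡ -1ℤ
flow-> {x} {a} a<x with x <? a
... | yes x<a = ⊥-elim (<-asym a<x x<a)
... | no _ with a <? x
...   | yes _    = refl
...   | no a≮x = ⊥-elim (a≮x a<x)

flow-≡ : ∀ x → flow x (just x) ≡ 0ℤ
flow-≡ x with x <? x
... | yes x<x = ⊥-elim (<-irrefl refl x<x)
... | no _ with x <? x
...   | yes x<x = ⊥-elim (<-irrefl refl x<x)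
...   | no _    = refl

data FlowView (x : ℤ) : Maybe ℤ → ℤ → Set where
  isolated : FlowView x nothing 0ℤ
  level    : FlowView x (just x) 0ℤ
  uphill   : ∀ {w} → x < w → FlowView x (just w) 1ℤ
  downhill : ∀ {w} → w < x → FlowView x (just w) -1ℤ

flow-view : ∀ x s → FlowView x s (flow x s)
flow-view x nothing = isolated
flow-view x (just a) with <-cmp x a
... | tri< x<a _ _ = subst (FlowView x (just a)) (sym (flow-< x<a)) (uphill x<a)
... | tri> _ _ a<x = subst (FlowView x (just a)) (sym (flow-> a<x)) (downhill a<x)
... | tri≈ _ refl _ = subst (FlowView x (just x)) (sym (flow-≡ x)) level

flow-antisym : ∀ x a → flow x (just a) ≡ - flow a (just x)
flow-antisym x a with flow x (just a) | flow-view x (just a)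
... | _ | level        = sym (cong -_ (flow-≡ x))
... | _ | uphill x<a   = sym (cong -_ (flow-> x<a))
... | _ | downhill a<x = sym (cong -_ (flow-< a<x))

flow-neg : ∀ x s → flow (- x) (map -_ s) ≡ - flow x s
flow-neg x s with flow x s | flow-view x s
... | _ | isolated     = refl
... | _ | level        = flow-≡ (- x)
... | _ | uphill x<w   = flow-> (neg-mono-< x<w)
... | _ | downhill w<x = flow-< (neg-mono-< w<x)

1+flow≡0⇒< : ∀ {x a} → 1ℤ ℤ.+ flow x (just a) ≡ 0ℤ → a < x
1+flow≡0⇒< {x} {a} eq with flow x (just a) | flow-view x (just a)
1+flow≡0⇒< () | _ | level
1+flow≡0⇒< () | _ | uphill _
... | _ | downhill a<x = a<x

x+0+1≡1+x : ∀ x → x ℤ.+ 0ℤ ℤ.+ 1ℤ ≡ 1ℤ ℤ.+ x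
x+0+1≡1+x = solve-∀

x-1+0≡-1+x : ∀ x → x ℤ.+ -1ℤ ℤ.+ 0ℤ ≡ -1ℤ ℤ.+ x
x-1+0≡-1+x = solve-∀

x-1+1≡x : ∀ x → x ℤ.+ -1ℤ ℤ.+ 1ℤ ≡ x
x-1+1≡x = solve-∀

uphill-forced : ∀ {x y} s → x < y → y < x ℤ.+ flow x s ℤ.+ 1ℤ → Σ ℤ λ w → s ≡ just w × x < w
uphill-forced {x} {y} s x<y y<x′ with flow x s | flow-view x s
... | _ | uphill x<w = _ , refl , x<w
... | _ | isolated   = ⊥-elim (≤⇒≯ (i<j⇒suc[i]≤j x<y) (subst (y <_) (x+0+1≡1+x x) y<x′))
... | _ | level      = ⊥-elim (≤⇒≯ (i<j⇒suc[i]≤j x<y) (subst (y <_) (x+0+1≡1+x x) y<x′))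
... | _ | downhill _ = ⊥-elim (<-asym x<y (subst (y <_) (x-1+1≡x x) y<x′))

downhill-forced : ∀ {y z} s → y < z → z ℤ.+ -1ℤ ℤ.+ flow z s < y → Σ ℤ λ w → s ≡ just w × w < z
downhill-forced {y} {z} s y<z z′<y with flow z s | flow-view z s
... | _ | downhill w<z = _ , refl , w<z
... | _ | isolated     = ⊥-elim (≤⇒≯ (i<j⇒i≤pred[j] y<z) (subst (_< y) (x-1+0≡-1+x z) z′<y))
... | _ | level        = ⊥-elim (≤⇒≯ (i<j⇒i≤pred[j] y<z) (subst (_< y) (x-1+0≡-1+x z) z′<y))
... | _ | uphill _     = ⊥-elim (<-asym y<z (subst (_< y) (x-1+1≡x z) z′<y))

stepAt : ∀ {n} → Config n → ℕ → ℤ → ℤ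
stepAt C m a = a ℤ.+ flow a (stack C m) ℤ.+ flow a (stack C (suc (suc m)))

stack-step : ∀ {n} (C : Config n) m {a} → stack C (suc m) ≡ just a →
  stack (step C) (suc m) ≡ just (stepAt C m a)
stack-step {n} C m h with m ℕ.<? n
... | yes p rewrite toℕ-fromℕ< p with h
...   | refl = refl
stack-step {n} C m () | no _

stack-pred : ∀ {n} (C : Config n) m {a} → stack C (suc (suc m)) ≡ just a →
  Σ ℤ λ b → stack C (suc m) ≡ just b
stack-pred {n} C m h with suc m ℕ.<? n | m ℕ.<? n
... | yes _   | yes q = C (fromℕ< q) , refl
... | yes 1+m<n | no m≮n = ⊥-elim (m≮n (ℕ.<-trans (ℕ.n<1+n m) 1+m<n))
stack-pred C m () | no _ | _

stack-cong : ∀ {n} {C C′ : Config n} → C ≈ C′ → ∀ k → stack C k ≡ stack C′ k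
stack-cong C≈C′ zero = refl
stack-cong {n} C≈C′ (suc m) with m ℕ.<? n
... | yes p = cong just (C≈C′ (fromℕ< p))
... | no _  = refl

step-cong : ∀ {n} {C C′ : Config n} → C ≈ C′ → step C ≈ step C′
step-cong C≈C′ i
  rewrite C≈C′ i | stack-cong C≈C′ (toℕ i) | stack-cong C≈C′ (suc (suc (toℕ i))) = refl

p2Config⇒period2 : ∀ {n} {D : Config n} → IsP2Config D → step (step D) ≈ D
p2Config⇒period2 (C₀ , N , periodic , t , N≤t , D≈Cₜ) i =
  trans (step-cong (step-cong D≈Cₜ) i) (trans (proj₁ (periodic t N≤t) i) (sym (D≈Cₜ i)))

round-trip-cancel : ∀ {a a′ l r l′ r′ : ℤ} → a′ ≡ a ℤ.+ l ℤ.+ r → a ≡ a′ ℤ.+ l′ ℤ.+ r′ →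
  l ℤ.+ l′ ≡ 0ℤ → r ℤ.+ r′ ≡ 0ℤ
round-trip-cancel {a} {a′} {l} {r} {l′} {r′} a′≡ a≡ l+l′≡0 = begin
  r ℤ.+ r′
    ≡⟨ regroup a a′ l r l′ r′ ⟩
  (a′ ℤ.+ l′ ℤ.+ r′ ℤ.- a) ℤ.+ (a ℤ.+ l ℤ.+ r ℤ.- a′) ℤ.- (l ℤ.+ l′)
    ≡⟨ cong₂ (λ u v → (u ℤ.- a) ℤ.+ (v ℤ.- a′) ℤ.- (l ℤ.+ l′)) (sym a≡) (sym a′≡) ⟩
  (a ℤ.- a) ℤ.+ (a′ ℤ.- a′) ℤ.- (l ℤ.+ l′)
    ≡⟨ cong (λ w → (a ℤ.- a) ℤ.+ (a′ ℤ.- a′) ℤ.- w) l+l′≡0 ⟩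
  (a ℤ.- a) ℤ.+ (a′ ℤ.- a′) ℤ.- 0ℤ
    ≡⟨ vanish a a′ ⟩
  0ℤ ∎
  where
  open ≡-Reasoning
  regroup : ∀ a a′ l r l′ r′ →
    r ℤ.+ r′ ≡ (a′ ℤ.+ l′ ℤ.+ r′ ℤ.- a) ℤ.+ (a ℤ.+ l ℤ.+ r ℤ.- a′) ℤ.- (l ℤ.+ l′)
  regroup = solve-∀
  vanish : ∀ a a′ → (a ℤ.- a) ℤ.+ (a′ ℤ.- a′) ℤ.- 0ℤ ≡ 0ℤ
  vanish = solve-∀

module PeriodTwo {n} (D : Config n) (period : step (step D) ≈ D) where

  D′ : Config n
  D′ = step D

  stepAt-returns : ∀ m {a} → stack D (suc m) ≡ just a → stepAt D′ m (stepAt D m a) ≡ a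
  stepAt-returns m {a} ha = just-injective (begin
    just (stepAt D′ m (stepAt D m a)) ≡⟨ sym (stack-step D′ m (stack-step D m ha)) ⟩
    stack (step D′) (suc m)          ≡⟨ stack-cong period (suc m) ⟩
    stack D (suc m)                  ≡⟨ ha ⟩
    just a                           ∎)
    where open ≡-Reasoning

  mutual
    leftFlows-cancel : ∀ m {a} → stack D (suc m) ≡ just a →
      flow a (stack D m) ℤ.+ flow (stepAt D m a) (stack D′ m) ≡ 0ℤ
    leftFlows-cancel zero ha = refl
    leftFlows-cancel (suc m) {a} ha with stack-pred D m ha
    ... | b , hb = begin
      flow a (stack D (suc m)) ℤ.+ flow a′ (stack D′ (suc m))
        ≡⟨ cong₂ (λ s s′ → flow a s ℤ.+ flow a′ s′) hb (stack-step D m hb) ⟩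
      flow a (just b) ℤ.+ flow a′ (just b′)
        ≡⟨ cong₂ ℤ._+_ (flow-antisym a b) (flow-antisym a′ b′) ⟩
      - flow b (just a) ℤ.+ - flow b′ (just a′)
        ≡⟨ sym (neg-distrib-+ (flow b (just a)) (flow b′ (just a′))) ⟩
      - (flow b (just a) ℤ.+ flow b′ (just a′))
        ≡⟨ cong -_ (edgeFlows-cancel m hb ha) ⟩
      0ℤ ∎
      where
      open ≡-Reasoning
      a′ = stepAt D (suc m) a
      b′ = stepAt D m b

    edgeFlows-cancel : ∀ m {a b} → stack D (suc m) ≡ just a → stack D (suc (suc m)) ≡ just b →
      flow a (just b) ℤ.+ flow (stepAt D m a) (just (stepAt D (suc m) b)) ≡ 0ℤ
    edgeFlows-cancel m {a} {b} ha hb = round-trip-cancel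
      (cong (λ s → a ℤ.+ flow a (stack D m) ℤ.+ flow a s) hb)
      (trans (sym (stepAt-returns m ha))
             (cong (λ s → a′ ℤ.+ flow a′ (stack D′ m) ℤ.+ flow a′ s) (stack-step D (suc m) hb)))
      (leftFlows-cancel m ha)
      where a′ = stepAt D m a

  rising-edge-falls : ∀ m {a b} → stack D (suc m) ≡ just a → stack D (suc (suc m)) ≡ just b →
    a < b → stepAt D (suc m) b < stepAt D m a
  rising-edge-falls m {a} {b} ha hb a<b = 1+flow≡0⇒< (trans
    (cong (ℤ._+ flow (stepAt D m a) (just (stepAt D (suc m) b))) (sym (flow-< a<b)))
    (edgeFlows-cancel m ha hb))

  module RisingPair {m x y z} (hx : stack D (suc m) ≡ just x) (hy : stack D (2 + m) ≡ just y)
    (hz : stack D (3 + m) ≡ just z) (x<y : x < y) (y<z : y < z) where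
    open ≡-Reasoning

    middle-stays : stepAt D (suc m) y ≡ y
    middle-stays = begin
      y ℤ.+ flow y (stack D (suc m)) ℤ.+ flow y (stack D (3 + m))
        ≡⟨ cong₂ (λ s t → y ℤ.+ flow y s ℤ.+ flow y t) hx hz ⟩
      y ℤ.+ flow y (just x) ℤ.+ flow y (just z)
        ≡⟨ cong₂ (λ f g → y ℤ.+ f ℤ.+ g) (flow-> x<y) (flow-< y<z) ⟩
      y ℤ.+ -1ℤ ℤ.+ 1ℤ
        ≡⟨ x-1+1≡x y ⟩
      y ∎

    left-end : LeftEdge D m
    left-end = let w , hw , x<w = uphill-forced (stack D m) x<y y<x′ in w , x , hw , hx , x<w
      where
      x′≡ : stepAt D m x ≡ x ℤ.+ flow x (stack D m) ℤ.+ 1ℤ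
      x′≡ = cong (λ f → x ℤ.+ flow x (stack D m) ℤ.+ f) (trans (cong (flow x) hy) (flow-< x<y))
      y<x′ : y < x ℤ.+ flow x (stack D m) ℤ.+ 1ℤ
      y<x′ = subst₂ _<_ middle-stays x′≡ (rising-edge-falls m hx hy x<y)

    right-end : LeftEdge D (3 + m)
    right-end = let u , hu , u<z = downhill-forced (stack D (4 + m)) y<z z′<y in z , u , hz , hu , u<z
      where
      z′≡ : stepAt D (2 + m) z ≡ z ℤ.+ -1ℤ ℤ.+ flow z (stack D (4 + m))
      z′≡ = cong (λ f → z ℤ.+ f ℤ.+ flow z (stack D (4 + m))) (trans (cong (flow z) hy) (flow-> y<z))
      z′<y : z ℤ.+ -1ℤ ℤ.+ flow z (stack D (4 + m)) < y
      z′<y = subst₂ _<_ z′≡ middle-stays (rising-edge-falls (suc m) hy hz y<z)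

  rightEdges⇒leftEdges : ∀ j → RightEdge D j → RightEdge D (suc j) →
    Σ ℕ λ i → j ≡ suc i × LeftEdge D i × LeftEdge D (j + 2)
  rightEdges⇒leftEdges zero (_ , _ , () , _)
  rightEdges⇒leftEdges (suc i) (x , y , hx , hy , x<y) (y′ , z , hy′ , hz , y′<z) =
    i , refl , left-end , subst (LeftEdge D) (sym (ℕ.+-comm (suc i) 2)) right-end
    where open RisingPair hx hy hz x<y (subst (_< z) (just-injective (trans (sym hy′) hy)) y′<z)

neg : ∀ {n} → Config n → Config n
neg C i = - C i

stack-neg : ∀ {n} (C : Config n) k → stack (neg C) k ≡ map -_ (stack C k)
stack-neg C zero = refl
stack-neg {n} C (suc m) with m ℕ.<? n
... | yes _ = refl
... | no _  = refl

step-neg : ∀ {n} (C : Config n) → step (neg C) ≈ neg (step C)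
step-neg C i = begin
  - x ℤ.+ flow (- x) (stack (neg C) (toℕ i)) ℤ.+ flow (- x) (stack (neg C) (suc (suc (toℕ i))))
    ≡⟨ cong₂ (λ s t → - x ℤ.+ flow (- x) s ℤ.+ flow (- x) t)
             (stack-neg C (toℕ i)) (stack-neg C (suc (suc (toℕ i)))) ⟩
  - x ℤ.+ flow (- x) (map -_ l) ℤ.+ flow (- x) (map -_ r)
    ≡⟨ cong₂ (λ f g → - x ℤ.+ f ℤ.+ g) (flow-neg x l) (flow-neg x r) ⟩
  - x ℤ.+ - flow x l ℤ.+ - flow x r
    ≡⟨ cong (ℤ._+ - flow x r) (sym (neg-distrib-+ x (flow x l))) ⟩
  - (x ℤ.+ flow x l) ℤ.+ - flow x r
    ≡⟨ sym (neg-distrib-+ (x ℤ.+ flow x l) (flow x r)) ⟩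
  - (x ℤ.+ flow x l ℤ.+ flow x r) ∎
  where
  open ≡-Reasoning
  x = C i
  l = stack C (toℕ i)
  r = stack C (suc (suc (toℕ i)))

period2-neg : ∀ {n} {D : Config n} → step (step D) ≈ D → step (step (neg D)) ≈ neg D
period2-neg {D = D} period i = trans (step-cong (step-neg D) i)
  (trans (step-neg (step D) i) (cong -_ (period i)))

leftEdge⇒rightEdge-neg : ∀ {n} {C : Config n} {j} → LeftEdge C j → RightEdge (neg C) j
leftEdge⇒rightEdge-neg {C = C} {j} (a , b , ha , hb , b<a) =
  - a , - b , trans (stack-neg C j) (map-just ha) , trans (stack-neg C (suc j)) (map-just hb) ,
  neg-mono-< b<a

map-neg-just : ∀ {s a} → map -_ s ≡ just a → s ≡ just (- a)
map-neg-just {just x} refl = cong just (sym (neg-involutive x))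

leftEdge-neg⇒rightEdge : ∀ {n} {C : Config n} {j} → LeftEdge (neg C) j → RightEdge C j
leftEdge-neg⇒rightEdge {C = C} {j} (a , b , ha , hb , b<a) =
  - a , - b , map-neg-just (trans (sym (stack-neg C j)) ha) ,
  map-neg-just (trans (sym (stack-neg C (suc j))) hb) , neg-mono-< b<a

lemma2p4 : ∀ (n : ℕ) (D : Config n) → IsP2Config D → ∀ (j : ℕ) →
    (RightEdge D j → RightEdge D (suc j) →
      Σ ℕ λ i → j ≡ suc i × LeftEdge D i × LeftEdge D (j + 2))
    × (LeftEdge D j → LeftEdge D (suc j) →
      Σ ℕ λ i → j ≡ suc i × RightEdge D i × RightEdge D (j + 2))
lemma2p4 _ D p2 j = PeriodTwo.rightEdges⇒leftEdges D period j , leftEdges⇒rightEdges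
  where
  period : step (step D) ≈ D
  period = p2Config⇒period2 p2

  leftEdges⇒rightEdges : LeftEdge D j → LeftEdge D (suc j) →
    Σ ℕ λ i → j ≡ suc i × RightEdge D i × RightEdge D (j + 2)
  leftEdges⇒rightEdges e e′ =
    let i , j≡1+i , l , l′ = PeriodTwo.rightEdges⇒leftEdges (neg D) (period2-neg period) j
                               (leftEdge⇒rightEdge-neg e) (leftEdge⇒rightEdge-neg e′)
    in i , j≡1+i , leftEdge-neg⇒rightEdge l , leftEdge-neg⇒rightEdge l′
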